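{- Let $A$ be an HT-formula and let $C'$ be an nh-NNF-formula such that $A \models C'$. Then there exists an HT-formula $C$ such that $A \models C$, $C \models C'$ and $\mathrm{voc}(C) \subseteq \mathrm{voc}(C')$. Moreover, such an HT-formula $C$ can be effectively constructed from $C'$.
   Context: The setting is the three-valued propositional logic of here and there (HT), extended by a unary operator $\mathrm{nh}$. Truth values are $\mathsf{F} < \mathsf{NF} < \mathsf{T}$ (linearly ordered). An assignment maps atoms to truth values, and formulas are evaluated as follows: $\bot$ has value $\mathsf{F}$, $\top$ has value $\mathsf{T}$; $\lnot A$ has value $\mathsf{T}$ if $A$ has value $\mathsf{F}$ and value $\mathsf{F}$ otherwise; $\mathrm{nh}(A)$ has value $\mathsf{F}$ if $A$ has value $\mathsf{T}$ and value $\mathsf{T}$ otherwise; $A \lor B$ has the maximum and $A \land B$ the minimum of the values of $A$ and $B$; $A \to B$ has value $\mathsf{T}$ if the value of $A$ is $\le$ the value of $B$, and otherwise has the value of $B$. HT-formulas are given by the grammar $A,B ::= \text{Atom} \mid \bot \mid \top \mid \lnot A \mid (A \lor B) \mid (A \land B) \mid (A \to B)$. nh-NNF-formulas are given by the grammar $A,B ::= \text{Atom} \mid \lnot \text{Atom} \mid \lnot\lnot\text{Atom} \mid \mathrm{nh}(\text{Atom}) \mid \bot \mid \top \mid (A \lor B) \mid (A \land B)$. $A \models B$ means that under every assignment of the atoms of $A$ and $B$ to truth values in $\{\mathsf{F},\mathsf{NF},\mathsf{T}\}$, the formula $A \to B$ has value $\mathsf{T}$ (equivalently, the value of $A$ is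 at most that of $B$). $\mathrm{voc}(A)$ denotes the set of atoms occurring in $A$. -}

module Defs where

open import Data.Nat using (ℕ)
open import Data.Product using (_×_)
open import Relation.Binary.PropositionalEquality using (_≡_)

Atom : Set
Atom = ℕ

data TV : Set where
  F NF T : TV

data _≤ᵥ_ : TV → TV → Set where
  F≤    : ∀ {x} → F ≤ᵥ x
  NF≤NF : NF ≤ᵥ NF
  NF≤T  : NF ≤ᵥ T
  T≤T   : T ≤ᵥ T

_≤ᵥ?_ : TV → TV → TV → TV → TV
(F ≤ᵥ? _) t e = t
(NF ≤ᵥ? F) t e = e
(NF ≤ᵥ? NF) t e = t
(NF ≤ᵥ? T) t e = t
(T ≤ᵥ? F) t e = e
(T ≤ᵥ? NF) t e = e
(T ≤ᵥ? T) t e = t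

max : TV → TV → TV
max F y = y
max NF F = NF
max NF y = y
max T _ = T

min : TV → TV → TV
min F _ = F
min NF F = F
min NF _ = NF
min T y = y

neg : TV → TV
neg F = T
neg _ = F

nhv : TV → TV
nhv T = F
nhv _ = T

imp : TV → TV → TV
imp a b = (a ≤ᵥ? b) T b

Assignment : Set
Assignment = Atom → TV

data HT : Set where
  atom : Atom → HT
  ⊥'   : HT
  ⊤'   : HT
  ¬'_  : HT → HT
  _∨'_ : HT → HT → HT
  _∧'_ : HT → HT → HT
  _⇒'_ : HT → HT → HT

data NNF : Set where
  atom   : Atom → NNF
  ¬atom  : Atom → NNF
  ¬¬atom : Atom → NNF
  nh     : Atom → NNF
  ⊥'     : NNF
  ⊤'     : NNF
  _∨'_   : NNF → NNF → NNF
  _∧'_   : NNF → NNF → NNF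

⟦_⟧ʰ : HT → Assignment → TV
⟦ atom p ⟧ʰ v = v p
⟦ ⊥' ⟧ʰ v = F
⟦ ⊤' ⟧ʰ v = T
⟦ ¬' A ⟧ʰ v = neg (⟦ A ⟧ʰ v)
⟦ A ∨' B ⟧ʰ v = max (⟦ A ⟧ʰ v) (⟦ B ⟧ʰ v)
⟦ A ∧' B ⟧ʰ v = min (⟦ A ⟧ʰ v) (⟦ B ⟧ʰ v)
⟦ A ⇒' B ⟧ʰ v = imp (⟦ A ⟧ʰ v) (⟦ B ⟧ʰ v)

⟦_⟧ⁿ : NNF → Assignment → TV
⟦ atom p ⟧ⁿ v = v p
⟦ ¬atom p ⟧ⁿ v = neg (v p)
⟦ ¬¬atom p ⟧ⁿ v = neg (neg (v p))
⟦ nh p ⟧ⁿ v = nhv (v p)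
⟦ ⊥' ⟧ⁿ v = F
⟦ ⊤' ⟧ⁿ v = T
⟦ A ∨' B ⟧ⁿ v = max (⟦ A ⟧ⁿ v) (⟦ B ⟧ⁿ v)
⟦ A ∧' B ⟧ⁿ v = min (⟦ A ⟧ⁿ v) (⟦ B ⟧ⁿ v)

_⊨ʰʰ_ : HT → HT → Set
A ⊨ʰʰ B = ∀ (v : Assignment) → imp (⟦ A ⟧ʰ v) (⟦ B ⟧ʰ v) ≡ T

_⊨ʰⁿ_ : HT → NNF → Set
A ⊨ʰⁿ B = ∀ (v : Assignment) → imp (⟦ A ⟧ʰ v) (⟦ B ⟧ⁿ v) ≡ T

data _∈ʰ_ (p : Atom) : HT → Set where
  here  : p ∈ʰ atom p
  ¬-in  : ∀ {A} → p ∈ʰ A → p ∈ʰ (¬' A)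
  ∨-inˡ : ∀ {A B} → p ∈ʰ A → p ∈ʰ (A ∨' B)
  ∨-inʳ : ∀ {A B} → p ∈ʰ B → p ∈ʰ (A ∨' B)
  ∧-inˡ : ∀ {A B} → p ∈ʰ A → p ∈ʰ (A ∧' B)
  ∧-inʳ : ∀ {A B} → p ∈ʰ B → p ∈ʰ (A ∧' B)
  ⇒-inˡ : ∀ {A B} → p ∈ʰ A → p ∈ʰ (A ⇒' B)
  ⇒-inʳ : ∀ {A B} → p ∈ʰ B → p ∈ʰ (A ⇒' B)

data _∈ⁿ_ (p : Atom) : NNF → Set where
  here   : p ∈ⁿ atom p
  here¬  : p ∈ⁿ ¬atom p
  here¬¬ : p ∈ⁿ ¬¬atom p
  herenh : p ∈ⁿ nh p
  ∨-inˡ  : ∀ {A B} → p ∈ⁿ A → p ∈ⁿ (A ∨' B)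
  ∨-inʳ  : ∀ {A B} → p ∈ⁿ B → p ∈ⁿ (A ∨' B)
  ∧-inˡ  : ∀ {A B} → p ∈ⁿ A → p ∈ⁿ (A ∧' B)
  ∧-inʳ  : ∀ {A B} → p ∈ⁿ B → p ∈ⁿ (A ∧' B)

_⊆voc_ : HT → NNF → Set
C ⊆voc C' = ∀ (p : Atom) → p ∈ʰ C → p ∈ⁿ C'

{-# OPTIONS --safe #-}
module Submission where

-- Read an assignment v as an HT-interpretation ⟨H, T⟩, so that `there ∘ v` is ⟨T, T⟩.
-- HT-formulas are persistent (their value at `there ∘ v` is `there` of their value at
-- v) and nh-NNF formulas are anti-persistent (their value at `there ∘ v` is at most
-- that).  Hence for an nh-NNF formula C' the value that is true here iff C' is T at v
-- and at `there ∘ v`, and true there iff C' is T at `there ∘ v`, lies below C' and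
-- above every HT-formula entailing C'.  It is the value of an HT-formula over voc(C'):
-- by Shannon expansion on an atom p it is the value for C'[nh p ≔ ⊤] conjoined with
-- p → (the value for C'[nh p ≔ ⊥]), and without nh, C' is itself an HT-formula.

open import Defs
open import Data.Nat using (_≟_)
open import Data.List using (List; []; _∷_; _++_)
open import Data.List.Properties using (++-conicalˡ; ++-conicalʳ)
open import Data.List.Membership.Propositional using (_∈_)
open import Data.List.Membership.Propositional.Properties using (∈-++⁺ˡ; ∈-++⁺ʳ; ∈-++⁻)
open import Data.List.Relation.Binary.Subset.Propositional using (_⊆_)
open import Data.List.Relation.Binary.Subset.Propositional.Properties
  using (⊆-refl; ⊆[]⇒≡[])
open import Data.List.Relation.Unary.Any as Any using (here)
open import Data.Product using (Σ; _×_; _,_)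
open import Data.Sum as Sum using (_⊎_; inj₁; inj₂; [_,_]′)
open import Function using (_∘_; id)
open import Relation.Nullary using (yes; no)
open import Relation.Binary.PropositionalEquality
  using (_≡_; refl; sym; trans; cong; cong₂; subst; module ≡-Reasoning)

there : TV → TV
there F  = F
there NF = T
there T  = T

-- The HT value that is true here iff c is T and true there iff d is T.
fromWorlds : TV → TV → TV
fromWorlds _ F  = F
fromWorlds _ NF = F
fromWorlds T T  = T
fromWorlds _ T  = NF

≤ᵥ-refl : ∀ a → a ≤ᵥ a
≤ᵥ-refl F  = F≤
≤ᵥ-refl NF = NF≤NF
≤ᵥ-refl T  = T≤T

≤ᵥ-T : ∀ a → a ≤ᵥ T
≤ᵥ-T F  = F≤
≤ᵥ-T NF = NF≤T
≤ᵥ-T T  = T≤T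

≤ᵥ⇒imp≡T : ∀ {a b} → a ≤ᵥ b → imp a b ≡ T
≤ᵥ⇒imp≡T F≤    = refl
≤ᵥ⇒imp≡T NF≤NF = refl
≤ᵥ⇒imp≡T NF≤T  = refl
≤ᵥ⇒imp≡T T≤T   = refl

imp≡T⇒≤ᵥ : ∀ a b → imp a b ≡ T → a ≤ᵥ b
imp≡T⇒≤ᵥ F  _  _  = F≤
imp≡T⇒≤ᵥ NF NF _  = NF≤NF
imp≡T⇒≤ᵥ NF T  _  = NF≤T
imp≡T⇒≤ᵥ T  T  _  = T≤T
imp≡T⇒≤ᵥ NF F  ()
imp≡T⇒≤ᵥ T  F  ()
imp≡T⇒≤ᵥ T  NF ()

max-mono-≤ᵥ : ∀ {a a′ b b′} → a ≤ᵥ a′ → b ≤ᵥ b′ → max a b ≤ᵥ max a′ b′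
max-mono-≤ᵥ {a′ = F}  F≤ b≤b′  = b≤b′
max-mono-≤ᵥ {a′ = NF} F≤ F≤    = F≤
max-mono-≤ᵥ {a′ = NF} F≤ NF≤NF = NF≤NF
max-mono-≤ᵥ {a′ = NF} F≤ NF≤T  = NF≤T
max-mono-≤ᵥ {a′ = NF} F≤ T≤T   = T≤T
max-mono-≤ᵥ {a′ = T}  F≤ _     = ≤ᵥ-T _
max-mono-≤ᵥ NF≤NF (F≤ {F})  = NF≤NF
max-mono-≤ᵥ NF≤NF (F≤ {NF}) = NF≤NF
max-mono-≤ᵥ NF≤NF (F≤ {T})  = NF≤T
max-mono-≤ᵥ NF≤NF NF≤NF     = NF≤NF
max-mono-≤ᵥ NF≤NF NF≤T      = NF≤T
max-mono-≤ᵥ NF≤NF T≤T       = T≤T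
max-mono-≤ᵥ NF≤T  _         = ≤ᵥ-T _
max-mono-≤ᵥ T≤T   _         = T≤T

min-mono-≤ᵥ : ∀ {a a′ b b′} → a ≤ᵥ a′ → b ≤ᵥ b′ → min a b ≤ᵥ min a′ b′
min-mono-≤ᵥ F≤    _     = F≤
min-mono-≤ᵥ NF≤NF F≤    = F≤
min-mono-≤ᵥ NF≤NF NF≤NF = NF≤NF
min-mono-≤ᵥ NF≤NF NF≤T  = NF≤NF
min-mono-≤ᵥ NF≤NF T≤T   = NF≤NF
min-mono-≤ᵥ NF≤T  F≤    = F≤
min-mono-≤ᵥ NF≤T  NF≤NF = NF≤NF
min-mono-≤ᵥ NF≤T  NF≤T  = NF≤T
min-mono-≤ᵥ NF≤T  T≤T   = NF≤T
min-mono-≤ᵥ T≤T   b≤b′  = b≤b′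

min-identityʳ : ∀ a → min a T ≡ a
min-identityʳ F  = refl
min-identityʳ NF = refl
min-identityʳ T  = refl

min-zeroʳ : ∀ a → min a F ≡ F
min-zeroʳ F  = refl
min-zeroʳ NF = refl
min-zeroʳ T  = refl

there-neg : ∀ a → there (neg a) ≡ neg (there a)
there-neg F  = refl
there-neg NF = refl
there-neg T  = refl

there-max : ∀ a b → there (max a b) ≡ max (there a) (there b)
there-max F  _  = refl
there-max NF F  = refl
there-max NF NF = refl
there-max NF T  = refl
there-max T  _  = refl

there-min : ∀ a b → there (min a b) ≡ min (there a) (there b)
there-min F  _  = refl
there-min NF F  = refl
there-min NF NF = refl
there-min NF T  = refl
there-min T  _  = refl

there-imp : ∀ a b → there (imp a b) ≡ imp (there a) (there b)
there-imp F  _  = refl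
there-imp NF F  = refl
there-imp NF NF = refl
there-imp NF T  = refl
there-imp T  F  = refl
there-imp T  NF = refl
there-imp T  T  = refl

nhv-there-≤ᵥ : ∀ a → nhv (there a) ≤ᵥ there (nhv a)
nhv-there-≤ᵥ F  = T≤T
nhv-there-≤ᵥ NF = F≤
nhv-there-≤ᵥ T  = F≤

fromWorlds-there : ∀ a → fromWorlds a (there a) ≡ a
fromWorlds-there F  = refl
fromWorlds-there NF = refl
fromWorlds-there T  = refl

≤ᵥ-fromWorlds : ∀ {a c d} → a ≤ᵥ c → there a ≤ᵥ d → a ≤ᵥ fromWorlds c d
≤ᵥ-fromWorlds F≤    _   = F≤
≤ᵥ-fromWorlds NF≤NF T≤T = NF≤NF
≤ᵥ-fromWorlds NF≤T  T≤T = NF≤T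
≤ᵥ-fromWorlds T≤T   T≤T = T≤T

fromWorlds-≤ᵥ : ∀ {c d} → d ≤ᵥ there c → fromWorlds c d ≤ᵥ c
fromWorlds-≤ᵥ {F}  F≤       = F≤
fromWorlds-≤ᵥ {NF} (F≤ {T}) = F≤
fromWorlds-≤ᵥ {NF} NF≤T     = F≤
fromWorlds-≤ᵥ {NF} T≤T      = NF≤NF
fromWorlds-≤ᵥ {T}  _        = ≤ᵥ-T _

-- f and g give the value of a formula, at v and at `there ∘ v`, as a function of
-- the value of one literal nh p; x is the value of p.
fromWorlds-shannon : ∀ x (f g : TV → TV) → f F ≤ᵥ f T → g F ≤ᵥ g T →
  fromWorlds (f (nhv x)) (g (nhv (there x)))
    ≡ min (fromWorlds (f T) (g T)) (imp x (fromWorlds (f F) (g F)))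
fromWorlds-shannon F  f g _      _      = sym (min-identityʳ _)
fromWorlds-shannon NF f g _      g-mono = shannon-NF (f T) (f F) g-mono
  where
  shannon-NF : ∀ a b {c d} → c ≤ᵥ d →
    fromWorlds a c ≡ min (fromWorlds a d) (imp NF (fromWorlds b c))
  shannon-NF a _  (F≤ {d}) = sym (min-zeroʳ (fromWorlds a d))
  shannon-NF a _  NF≤NF    = refl
  shannon-NF a _  NF≤T     = sym (min-zeroʳ (fromWorlds a T))
  shannon-NF a F  T≤T      = sym (min-identityʳ _)
  shannon-NF a NF T≤T      = sym (min-identityʳ _)
  shannon-NF a T  T≤T      = sym (min-identityʳ _)
fromWorlds-shannon T  f g f-mono g-mono = shannon-T f-mono g-mono
  where
  shannon-T : ∀ {a⁻ a⁺ b⁻ b⁺} → a⁻ ≤ᵥ a⁺ → b⁻ ≤ᵥ b⁺ →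
    fromWorlds a⁻ b⁻ ≡ min (fromWorlds a⁺ b⁺) (imp T (fromWorlds a⁻ b⁻))
  shannon-T _         F≤        = sym (min-zeroʳ _)
  shannon-T _         NF≤NF     = refl
  shannon-T _         NF≤T      = sym (min-zeroʳ _)
  shannon-T (F≤ {F})  T≤T       = refl
  shannon-T (F≤ {NF}) T≤T       = refl
  shannon-T (F≤ {T})  T≤T       = refl
  shannon-T NF≤NF     T≤T       = refl
  shannon-T NF≤T      T≤T       = refl
  shannon-T T≤T       T≤T       = refl

⟦⟧ʰ-there : ∀ A v → ⟦ A ⟧ʰ (there ∘ v) ≡ there (⟦ A ⟧ʰ v)
⟦⟧ʰ-there (atom p) v = refl
⟦⟧ʰ-there ⊥'       v = refl
⟦⟧ʰ-there ⊤'       v = refl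
⟦⟧ʰ-there (¬' A)   v = trans (cong neg (⟦⟧ʰ-there A v)) (sym (there-neg _))
⟦⟧ʰ-there (A ∨' B) v =
  trans (cong₂ max (⟦⟧ʰ-there A v) (⟦⟧ʰ-there B v)) (sym (there-max (⟦ A ⟧ʰ v) (⟦ B ⟧ʰ v)))
⟦⟧ʰ-there (A ∧' B) v =
  trans (cong₂ min (⟦⟧ʰ-there A v) (⟦⟧ʰ-there B v)) (sym (there-min (⟦ A ⟧ʰ v) (⟦ B ⟧ʰ v)))
⟦⟧ʰ-there (A ⇒' B) v =
  trans (cong₂ imp (⟦⟧ʰ-there A v) (⟦⟧ʰ-there B v)) (sym (there-imp (⟦ A ⟧ʰ v) (⟦ B ⟧ʰ v)))

⟦⟧ⁿ-there-≤ᵥ : ∀ C v → ⟦ C ⟧ⁿ (there ∘ v) ≤ᵥ there (⟦ C ⟧ⁿ v)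
⟦⟧ⁿ-there-≤ᵥ (atom p)   v = ≤ᵥ-refl _
⟦⟧ⁿ-there-≤ᵥ (¬atom p)  v rewrite there-neg (v p) = ≤ᵥ-refl _
⟦⟧ⁿ-there-≤ᵥ (¬¬atom p) v rewrite there-neg (neg (v p)) | there-neg (v p) = ≤ᵥ-refl _
⟦⟧ⁿ-there-≤ᵥ (nh p)     v = nhv-there-≤ᵥ (v p)
⟦⟧ⁿ-there-≤ᵥ ⊥'         v = F≤
⟦⟧ⁿ-there-≤ᵥ ⊤'         v = T≤T
⟦⟧ⁿ-there-≤ᵥ (A ∨' B)   v rewrite there-max (⟦ A ⟧ⁿ v) (⟦ B ⟧ⁿ v) =
  max-mono-≤ᵥ (⟦⟧ⁿ-there-≤ᵥ A v) (⟦⟧ⁿ-there-≤ᵥ B v)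
⟦⟧ⁿ-there-≤ᵥ (A ∧' B)   v rewrite there-min (⟦ A ⟧ⁿ v) (⟦ B ⟧ⁿ v) =
  min-mono-≤ᵥ (⟦⟧ⁿ-there-≤ᵥ A v) (⟦⟧ⁿ-there-≤ᵥ B v)

infixl 30 _[nh_≔_]

_[nh_≔_] : NNF → Atom → NNF → NNF
atom q   [nh p ≔ D ] = atom q
¬atom q  [nh p ≔ D ] = ¬atom q
¬¬atom q [nh p ≔ D ] = ¬¬atom q
nh q     [nh p ≔ D ] with p ≟ q
... | yes _ = D
... | no  _ = nh q
⊥'       [nh p ≔ D ] = ⊥'
⊤'       [nh p ≔ D ] = ⊤'
(A ∨' B) [nh p ≔ D ] = A [nh p ≔ D ] ∨' B [nh p ≔ D ]
(A ∧' B) [nh p ≔ D ] = A [nh p ≔ D ] ∧' B [nh p ≔ D ]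

⟦_∣nh_↦_⟧ⁿ : NNF → Atom → TV → Assignment → TV
⟦ nh q ∣nh p ↦ x ⟧ⁿ w with p ≟ q
... | yes _ = x
... | no  _ = nhv (w q)
⟦ A ∨' B ∣nh p ↦ x ⟧ⁿ w = max (⟦ A ∣nh p ↦ x ⟧ⁿ w) (⟦ B ∣nh p ↦ x ⟧ⁿ w)
⟦ A ∧' B ∣nh p ↦ x ⟧ⁿ w = min (⟦ A ∣nh p ↦ x ⟧ⁿ w) (⟦ B ∣nh p ↦ x ⟧ⁿ w)
⟦ C ∣nh p ↦ x ⟧ⁿ w = ⟦ C ⟧ⁿ w

⟦∣nh↦nhv⟧ⁿ : ∀ C w p → ⟦ C ∣nh p ↦ nhv (w p) ⟧ⁿ w ≡ ⟦ C ⟧ⁿ w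
⟦∣nh↦nhv⟧ⁿ (atom q)   w p = refl
⟦∣nh↦nhv⟧ⁿ (¬atom q)  w p = refl
⟦∣nh↦nhv⟧ⁿ (¬¬atom q) w p = refl
⟦∣nh↦nhv⟧ⁿ (nh q)     w p with p ≟ q
... | yes refl = refl
... | no  _    = refl
⟦∣nh↦nhv⟧ⁿ ⊥'         w p = refl
⟦∣nh↦nhv⟧ⁿ ⊤'         w p = refl
⟦∣nh↦nhv⟧ⁿ (A ∨' B)   w p = cong₂ max (⟦∣nh↦nhv⟧ⁿ A w p) (⟦∣nh↦nhv⟧ⁿ B w p)
⟦∣nh↦nhv⟧ⁿ (A ∧' B)   w p = cong₂ min (⟦∣nh↦nhv⟧ⁿ A w p) (⟦∣nh↦nhv⟧ⁿ B w p)

⟦[nh≔]⟧ⁿ : ∀ C p D w → ⟦ C [nh p ≔ D ] ⟧ⁿ w ≡ ⟦ C ∣nh p ↦ ⟦ D ⟧ⁿ w ⟧ⁿ w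
⟦[nh≔]⟧ⁿ (atom q)   p D w = refl
⟦[nh≔]⟧ⁿ (¬atom q)  p D w = refl
⟦[nh≔]⟧ⁿ (¬¬atom q) p D w = refl
⟦[nh≔]⟧ⁿ (nh q)     p D w with p ≟ q
... | yes _ = refl
... | no  _ = refl
⟦[nh≔]⟧ⁿ ⊥'         p D w = refl
⟦[nh≔]⟧ⁿ ⊤'         p D w = refl
⟦[nh≔]⟧ⁿ (A ∨' B)   p D w = cong₂ max (⟦[nh≔]⟧ⁿ A p D w) (⟦[nh≔]⟧ⁿ B p D w)
⟦[nh≔]⟧ⁿ (A ∧' B)   p D w = cong₂ min (⟦[nh≔]⟧ⁿ A p D w) (⟦[nh≔]⟧ⁿ B p D w)

⟦∣nh↦⟧ⁿ-mono : ∀ C w p {x y} → x ≤ᵥ y → ⟦ C ∣nh p ↦ x ⟧ⁿ w ≤ᵥ ⟦ C ∣nh p ↦ y ⟧ⁿ w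
⟦∣nh↦⟧ⁿ-mono (atom q)   w p x≤y = ≤ᵥ-refl _
⟦∣nh↦⟧ⁿ-mono (¬atom q)  w p x≤y = ≤ᵥ-refl _
⟦∣nh↦⟧ⁿ-mono (¬¬atom q) w p x≤y = ≤ᵥ-refl _
⟦∣nh↦⟧ⁿ-mono (nh q)     w p x≤y with p ≟ q
... | yes _ = x≤y
... | no  _ = ≤ᵥ-refl _
⟦∣nh↦⟧ⁿ-mono ⊥'         w p x≤y = F≤
⟦∣nh↦⟧ⁿ-mono ⊤'         w p x≤y = T≤T
⟦∣nh↦⟧ⁿ-mono (A ∨' B)   w p x≤y =
  max-mono-≤ᵥ (⟦∣nh↦⟧ⁿ-mono A w p x≤y) (⟦∣nh↦⟧ⁿ-mono B w p x≤y)
⟦∣nh↦⟧ⁿ-mono (A ∧' B)   w p x≤y =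
  min-mono-≤ᵥ (⟦∣nh↦⟧ⁿ-mono A w p x≤y) (⟦∣nh↦⟧ⁿ-mono B w p x≤y)

∈ⁿ-[nh≔] : ∀ C p D {q} → q ∈ⁿ C [nh p ≔ D ] → q ∈ⁿ C ⊎ q ∈ⁿ D
∈ⁿ-[nh≔] (atom r)   p D h = inj₁ h
∈ⁿ-[nh≔] (¬atom r)  p D h = inj₁ h
∈ⁿ-[nh≔] (¬¬atom r) p D h = inj₁ h
∈ⁿ-[nh≔] (nh r)     p D h with p ≟ r
... | yes _ = inj₂ h
... | no  _ = inj₁ h
∈ⁿ-[nh≔] ⊥'         p D ()
∈ⁿ-[nh≔] ⊤'         p D ()
∈ⁿ-[nh≔] (A ∨' B)   p D (∨-inˡ h) = Sum.map₁ ∨-inˡ (∈ⁿ-[nh≔] A p D h)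
∈ⁿ-[nh≔] (A ∨' B)   p D (∨-inʳ h) = Sum.map₁ ∨-inʳ (∈ⁿ-[nh≔] B p D h)
∈ⁿ-[nh≔] (A ∧' B)   p D (∧-inˡ h) = Sum.map₁ ∧-inˡ (∈ⁿ-[nh≔] A p D h)
∈ⁿ-[nh≔] (A ∧' B)   p D (∧-inʳ h) = Sum.map₁ ∧-inʳ (∈ⁿ-[nh≔] B p D h)

nhAtoms : NNF → List Atom
nhAtoms (nh p)   = p ∷ []
nhAtoms (A ∨' B) = nhAtoms A ++ nhAtoms B
nhAtoms (A ∧' B) = nhAtoms A ++ nhAtoms B
nhAtoms _        = []

nhAtoms-∈ⁿ : ∀ C {q} → q ∈ nhAtoms C → q ∈ⁿ C
nhAtoms-∈ⁿ (nh p)   (here refl) = herenh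
nhAtoms-∈ⁿ (A ∨' B) m =
  [ ∨-inˡ ∘ nhAtoms-∈ⁿ A , ∨-inʳ ∘ nhAtoms-∈ⁿ B ]′ (∈-++⁻ (nhAtoms A) m)
nhAtoms-∈ⁿ (A ∧' B) m =
  [ ∧-inˡ ∘ nhAtoms-∈ⁿ A , ∧-inʳ ∘ nhAtoms-∈ⁿ B ]′ (∈-++⁻ (nhAtoms A) m)

nhAtoms-[nh≔]-⊆ : ∀ C {p D L} →
  nhAtoms C ⊆ p ∷ L → nhAtoms D ⊆ L → nhAtoms (C [nh p ≔ D ]) ⊆ L
nhAtoms-[nh≔]-⊆ (nh q) {p} C⊆ D⊆ m with p ≟ q
nhAtoms-[nh≔]-⊆ (nh q) C⊆ D⊆ m           | yes _   = D⊆ m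
nhAtoms-[nh≔]-⊆ (nh q) C⊆ D⊆ (here refl) | no  p≢q = Any.tail (p≢q ∘ sym) (C⊆ (here refl))
nhAtoms-[nh≔]-⊆ (A ∨' B) C⊆ D⊆ m =
  [ nhAtoms-[nh≔]-⊆ A (C⊆ ∘ ∈-++⁺ˡ) D⊆ , nhAtoms-[nh≔]-⊆ B (C⊆ ∘ ∈-++⁺ʳ (nhAtoms A)) D⊆ ]′
    (∈-++⁻ (nhAtoms (A [nh _ ≔ _ ])) m)
nhAtoms-[nh≔]-⊆ (A ∧' B) C⊆ D⊆ m =
  [ nhAtoms-[nh≔]-⊆ A (C⊆ ∘ ∈-++⁺ˡ) D⊆ , nhAtoms-[nh≔]-⊆ B (C⊆ ∘ ∈-++⁺ʳ (nhAtoms A)) D⊆ ]′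
    (∈-++⁻ (nhAtoms (A [nh _ ≔ _ ])) m)

-- The clause for nh is junk: embed is only used on formulas without nh.
embed : NNF → HT
embed (atom p)   = atom p
embed (¬atom p)  = ¬' atom p
embed (¬¬atom p) = ¬' (¬' atom p)
embed (nh p)     = ⊥'
embed ⊥'         = ⊥'
embed ⊤'         = ⊤'
embed (A ∨' B)   = embed A ∨' embed B
embed (A ∧' B)   = embed A ∧' embed B

⟦embed⟧ : ∀ C → nhAtoms C ≡ [] → ∀ v → ⟦ embed C ⟧ʰ v ≡ ⟦ C ⟧ⁿ v
⟦embed⟧ (atom p)   _  v = refl
⟦embed⟧ (¬atom p)  _  v = refl
⟦embed⟧ (¬¬atom p) _  v = refl
⟦embed⟧ (nh p)     () v
⟦embed⟧ ⊥'         _  v = refl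
⟦embed⟧ ⊤'         _  v = refl
⟦embed⟧ (A ∨' B)   nf v =
  cong₂ max (⟦embed⟧ A (++-conicalˡ _ _ nf) v) (⟦embed⟧ B (++-conicalʳ (nhAtoms A) _ nf) v)
⟦embed⟧ (A ∧' B)   nf v =
  cong₂ min (⟦embed⟧ A (++-conicalˡ _ _ nf) v) (⟦embed⟧ B (++-conicalʳ (nhAtoms A) _ nf) v)

∈ʰ-embed : ∀ C {q} → q ∈ʰ embed C → q ∈ⁿ C
∈ʰ-embed (atom p)   here               = here
∈ʰ-embed (¬atom p)  (¬-in here)        = here¬
∈ʰ-embed (¬¬atom p) (¬-in (¬-in here)) = here¬¬
∈ʰ-embed (A ∨' B)   (∨-inˡ h)          = ∨-inˡ (∈ʰ-embed A h)
∈ʰ-embed (A ∨' B)   (∨-inʳ h)          = ∨-inʳ (∈ʰ-embed B h)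
∈ʰ-embed (A ∧' B)   (∧-inˡ h)          = ∧-inˡ (∈ʰ-embed A h)
∈ʰ-embed (A ∧' B)   (∧-inʳ h)          = ∧-inʳ (∈ʰ-embed B h)

htInteriorᵥ : NNF → Assignment → TV
htInteriorᵥ C v = fromWorlds (⟦ C ⟧ⁿ v) (⟦ C ⟧ⁿ (there ∘ v))

htInteriorᵥ-nhFree : ∀ C → nhAtoms C ≡ [] → ∀ v → htInteriorᵥ C v ≡ ⟦ embed C ⟧ʰ v
htInteriorᵥ-nhFree C nf v = begin
  fromWorlds (⟦ C ⟧ⁿ v) (⟦ C ⟧ⁿ (there ∘ v))
    ≡⟨ sym (cong₂ fromWorlds (⟦embed⟧ C nf v) (⟦embed⟧ C nf (there ∘ v))) ⟩
  fromWorlds (⟦ embed C ⟧ʰ v) (⟦ embed C ⟧ʰ (there ∘ v))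
    ≡⟨ cong (fromWorlds (⟦ embed C ⟧ʰ v)) (⟦⟧ʰ-there (embed C) v) ⟩
  fromWorlds (⟦ embed C ⟧ʰ v) (there (⟦ embed C ⟧ʰ v))
    ≡⟨ fromWorlds-there (⟦ embed C ⟧ʰ v) ⟩
  ⟦ embed C ⟧ʰ v ∎
  where open ≡-Reasoning

htInteriorᵥ-shannon : ∀ C p v →
  htInteriorᵥ C v
    ≡ min (htInteriorᵥ (C [nh p ≔ ⊤' ]) v) (imp (v p) (htInteriorᵥ (C [nh p ≔ ⊥' ]) v))
htInteriorᵥ-shannon C p v = begin
  fromWorlds (⟦ C ⟧ⁿ v) (⟦ C ⟧ⁿ (there ∘ v))
    ≡⟨ sym (cong₂ fromWorlds (⟦∣nh↦nhv⟧ⁿ C v p) (⟦∣nh↦nhv⟧ⁿ C (there ∘ v) p)) ⟩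
  fromWorlds (f (nhv (v p))) (g (nhv (there (v p))))
    ≡⟨ fromWorlds-shannon (v p) f g
         (⟦∣nh↦⟧ⁿ-mono C v p F≤) (⟦∣nh↦⟧ⁿ-mono C (there ∘ v) p F≤) ⟩
  min (fromWorlds (f T) (g T)) (imp (v p) (fromWorlds (f F) (g F)))
    ≡⟨ sym (cong₂ (λ a b → min a (imp (v p) b)) (substituted ⊤') (substituted ⊥')) ⟩
  min (htInteriorᵥ (C [nh p ≔ ⊤' ]) v) (imp (v p) (htInteriorᵥ (C [nh p ≔ ⊥' ]) v)) ∎
  where
  open ≡-Reasoning
  f g : TV → TV
  f x = ⟦ C ∣nh p ↦ x ⟧ⁿ v
  g x = ⟦ C ∣nh p ↦ x ⟧ⁿ (there ∘ v)
  substituted : ∀ D →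
    htInteriorᵥ (C [nh p ≔ D ]) v ≡ fromWorlds (f (⟦ D ⟧ⁿ v)) (g (⟦ D ⟧ⁿ (there ∘ v)))
  substituted D = cong₂ fromWorlds (⟦[nh≔]⟧ⁿ C p D v) (⟦[nh≔]⟧ⁿ C p D (there ∘ v))

expand : List Atom → NNF → HT
expand []      C = embed C
expand (p ∷ L) C = expand L (C [nh p ≔ ⊤' ]) ∧' (atom p ⇒' expand L (C [nh p ≔ ⊥' ]))

⟦expand⟧ : ∀ L C → nhAtoms C ⊆ L → ∀ v → ⟦ expand L C ⟧ʰ v ≡ htInteriorᵥ C v
⟦expand⟧ []      C C⊆[] v = sym (htInteriorᵥ-nhFree C (⊆[]⇒≡[] C⊆[]) v)
⟦expand⟧ (p ∷ L) C C⊆ v =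
  trans (cong₂ (λ a b → min a (imp (v p) b))
               (⟦expand⟧ L _ (nhAtoms-[nh≔]-⊆ C C⊆ λ ()) v)
               (⟦expand⟧ L _ (nhAtoms-[nh≔]-⊆ C C⊆ λ ()) v))
        (sym (htInteriorᵥ-shannon C p v))

∈ʰ-expand : ∀ L C {q} → q ∈ʰ expand L C → q ∈ L ⊎ q ∈ⁿ C
∈ʰ-expand []      C h                    = inj₂ (∈ʰ-embed C h)
∈ʰ-expand (p ∷ L) C (∧-inˡ h)            =
  Sum.map Any.there ([ id , (λ ()) ]′ ∘ ∈ⁿ-[nh≔] C p ⊤') (∈ʰ-expand L _ h)
∈ʰ-expand (p ∷ L) C (∧-inʳ (⇒-inˡ here)) = inj₁ (here refl)
∈ʰ-expand (p ∷ L) C (∧-inʳ (⇒-inʳ h))    =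
  Sum.map Any.there ([ id , (λ ()) ]′ ∘ ∈ⁿ-[nh≔] C p ⊥') (∈ʰ-expand L _ h)

htInterior : NNF → HT
htInterior C = expand (nhAtoms C) C

⟦htInterior⟧ : ∀ C v → ⟦ htInterior C ⟧ʰ v ≡ htInteriorᵥ C v
⟦htInterior⟧ C = ⟦expand⟧ (nhAtoms C) C ⊆-refl

⊨-htInterior : ∀ A C → A ⊨ʰⁿ C → A ⊨ʰʰ htInterior C
⊨-htInterior A C A⊨C v rewrite ⟦htInterior⟧ C v =
  ≤ᵥ⇒imp≡T (≤ᵥ-fromWorlds (below v) there-below)
  where
  below : ∀ w → ⟦ A ⟧ʰ w ≤ᵥ ⟦ C ⟧ⁿ w
  below w = imp≡T⇒≤ᵥ _ _ (A⊨C w)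

  there-below : there (⟦ A ⟧ʰ v) ≤ᵥ ⟦ C ⟧ⁿ (there ∘ v)
  there-below = subst (_≤ᵥ ⟦ C ⟧ⁿ (there ∘ v)) (⟦⟧ʰ-there A v) (below (there ∘ v))

htInterior-⊨ : ∀ C → htInterior C ⊨ʰⁿ C
htInterior-⊨ C v rewrite ⟦htInterior⟧ C v = ≤ᵥ⇒imp≡T (fromWorlds-≤ᵥ (⟦⟧ⁿ-there-≤ᵥ C v))

htInterior-⊆voc : ∀ C → htInterior C ⊆voc C
htInterior-⊆voc C q h = [ nhAtoms-∈ⁿ C , id ]′ (∈ʰ-expand (nhAtoms C) C h)

theorem2 : Σ (NNF → HT) (λ f →
    ∀ (A : HT) (C' : NNF) → A ⊨ʰⁿ C' →
    (A ⊨ʰʰ f C') × (f C' ⊨ʰⁿ C') × (f C' ⊆voc C'))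
theorem2 = htInterior , λ A C' A⊨C' →
  ⊨-htInterior A C' A⊨C' , htInterior-⊨ C' , htInterior-⊆voc C'
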